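{- Suppose $\tau\colon LP\to UL'P'$ is a translation from $(L',\rho')$ to $(L,\rho)$ and $(B,\pi_1,\pi_2)$ is a $\rho'$-bisimulation between $T$-coalgebras $(X_1,\gamma_1)$ and $(X_2,\gamma_2)$. Then $(B,\pi_1,\pi_2)$ is also a $\rho$-bisimulation between them.
   Context: Let $\mathcal C,\mathcal A,\mathcal A'$ be categories, $\mathcal C$ with pullbacks and pushouts. Let $U\colon\mathcal A'\to\mathcal A$ have a left adjoint $F\colon\mathcal A\to\mathcal A'$. Let $P'\colon\mathcal C\to\mathcal A'$ be a contravariant functor that is part of a dual adjunction, and let $P=U\circ P'\colon\mathcal C\to\mathcal A$ also be part of a dual adjunction (a dual adjunction is a pair of contravariant functors with a natural bijection $\mathcal C(X,SA)\cong\mathcal A(A,PX)$). Let $T\colon\mathcal C\to\mathcal C$ be an endofunctor (a $T$-coalgebra is $(X,\gamma)$ with $\gamma\colon X\to TX$), and let $L'\colon\mathcal A'\to\mathcal A'$ with $\rho'\colon L'P'\to P'T$ and $L\colon\mathcal A\to\mathcal A$ with $\rho\colon LP\to PT$ be logics (natural transformations). A translation from $(L',\rho')$ to $(L,\rho)$ is a natural transformation $\tau\colon LP\to UL'P'$ with $\rho=U\rho'\circ\tau$. For a jointly mono span $X_1\xleftarrow{\pi_1}B\xrightarrow{\pi_2}X_2$ in $\mathcal C$ (i.e. $\pi_1h=\pi_1h'$, $\pi_2h=\pi_2h'$ imply $h=h'$), its $\rho$-dual span $(\bar B,\bar\pi_1,\bar\pi_2)$ is the pullback in $\mathcal A$ of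 $PX_1\xrightarrow{P\pi_1}PB\xleftarrow{P\pi_2}PX_2$, and the span is a $\rho$-bisimulation if $P\pi_1\circ P\gamma_1\circ\rho_{X_1}\circ L\bar\pi_1=P\pi_2\circ P\gamma_2\circ\rho_{X_2}\circ L\bar\pi_2$; $\rho'$-bisimulations are defined in the same way using $P'$, $L'$, $\rho'$ and the pullback in $\mathcal A'$. -}

module Defs where

open import Level using (Level; _⊔_) renaming (suc to lsuc)
open import Relation.Binary using (Rel; IsEquivalence)
open import Data.Product using (Σ; _×_; _,_)

record Category (o ℓ e : Level) : Set (lsuc (o ⊔ ℓ ⊔ e)) where
  infix  4 _≈_
  infixr 9 _∘_
  field
    Obj : Set o
    _⇒_ : Obj → Obj → Set ℓ
    _≈_ : ∀ {A B} → Rel (A ⇒ B) e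
    id  : ∀ {A} → A ⇒ A
    _∘_ : ∀ {A B C} → B ⇒ C → A ⇒ B → A ⇒ C
    assoc     : ∀ {A B C D} {f : A ⇒ B} {g : B ⇒ C} {h : C ⇒ D} →
                (h ∘ g) ∘ f ≈ h ∘ (g ∘ f)
    identityˡ : ∀ {A B} {f : A ⇒ B} → id ∘ f ≈ f
    identityʳ : ∀ {A B} {f : A ⇒ B} → f ∘ id ≈ f
    equiv     : ∀ {A B} → IsEquivalence (_≈_ {A} {B})
    ∘-resp-≈  : ∀ {A B C} {f h : B ⇒ C} {g i : A ⇒ B} →
                f ≈ h → g ≈ i → f ∘ g ≈ h ∘ i

record Functor {o ℓ e o′ ℓ′ e′} (C : Category o ℓ e) (D : Category o′ ℓ′ e′)
       : Set (o ⊔ ℓ ⊔ e ⊔ o′ ⊔ ℓ′ ⊔ e′) where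
  private
    module C = Category C
    module D = Category D
  field
    F₀ : C.Obj → D.Obj
    F₁ : ∀ {X Y} → X C.⇒ Y → F₀ X D.⇒ F₀ Y
    identity     : ∀ {X} → F₁ (C.id {X}) D.≈ D.id
    homomorphism : ∀ {X Y Z} {f : X C.⇒ Y} {g : Y C.⇒ Z} →
                   F₁ (g C.∘ f) D.≈ F₁ g D.∘ F₁ f
    F-resp-≈     : ∀ {X Y} {f g : X C.⇒ Y} → f C.≈ g → F₁ f D.≈ F₁ g

record ContraFunctor {o ℓ e o′ ℓ′ e′} (C : Category o ℓ e) (D : Category o′ ℓ′ e′)
       : Set (o ⊔ ℓ ⊔ e ⊔ o′ ⊔ ℓ′ ⊔ e′) where
  private
    module C = Category C
    module D = Category D
  field
    F₀ : C.Obj → D.Obj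
    F₁ : ∀ {X Y} → X C.⇒ Y → F₀ Y D.⇒ F₀ X
    identity     : ∀ {X} → F₁ (C.id {X}) D.≈ D.id
    homomorphism : ∀ {X Y Z} {f : X C.⇒ Y} {g : Y C.⇒ Z} →
                   F₁ (g C.∘ f) D.≈ F₁ f D.∘ F₁ g
    F-resp-≈     : ∀ {X Y} {f g : X C.⇒ Y} → f C.≈ g → F₁ f D.≈ F₁ g

module _ {o ℓ e o′ ℓ′ e′ o″ ℓ″ e″}
         {C : Category o ℓ e} {D : Category o′ ℓ′ e′} {E : Category o″ ℓ″ e″} where
  private
    module D = Category D
    module E = Category E

  _∘FC_ : Functor D E → ContraFunctor C D → ContraFunctor C E
  G ∘FC H = record
    { F₀ = λ X → G.F₀ (H.F₀ X)
    ; F₁ = λ f → G.F₁ (H.F₁ f)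
    ; identity = λ {X} → IsEquivalence.trans E.equiv (G.F-resp-≈ (H.identity {X})) G.identity
    ; homomorphism = λ {X Y Z f g} → IsEquivalence.trans E.equiv (G.F-resp-≈ (H.homomorphism {X} {Y} {Z} {f} {g})) G.homomorphism
    ; F-resp-≈ = λ p → G.F-resp-≈ (H.F-resp-≈ p)
    }
    where
      module G = Functor G
      module H = ContraFunctor H

  _∘CF_ : ContraFunctor D E → Functor C D → ContraFunctor C E
  H ∘CF G = record
    { F₀ = λ X → H.F₀ (G.F₀ X)
    ; F₁ = λ f → H.F₁ (G.F₁ f)
    ; identity = λ {X} → IsEquivalence.trans E.equiv (H.F-resp-≈ (G.identity {X})) H.identity
    ; homomorphism = λ {X Y Z f g} → IsEquivalence.trans E.equiv (H.F-resp-≈ (G.homomorphism {X} {Y} {Z} {f} {g})) H.homomorphism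
    ; F-resp-≈ = λ p → H.F-resp-≈ (G.F-resp-≈ p)
    }
    where
      module G = Functor G
      module H = ContraFunctor H

record ContraNT {o ℓ e o′ ℓ′ e′} {C : Category o ℓ e} {D : Category o′ ℓ′ e′}
       (F G : ContraFunctor C D) : Set (o ⊔ ℓ ⊔ e ⊔ o′ ⊔ ℓ′ ⊔ e′) where
  private
    module C = Category C
    module D = Category D
    module F = ContraFunctor F
    module G = ContraFunctor G
  field
    η       : ∀ X → F.F₀ X D.⇒ G.F₀ X
    commute : ∀ {X Y} (f : X C.⇒ Y) → η X D.∘ F.F₁ f D.≈ G.F₁ f D.∘ η Y

record Adjunction {o ℓ e o′ ℓ′ e′} {C : Category o ℓ e} {D : Category o′ ℓ′ e′}
       (F : Functor C D) (U : Functor D C) : Set (o ⊔ ℓ ⊔ e ⊔ o′ ⊔ ℓ′ ⊔ e′) where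
  private
    module C = Category C
    module D = Category D
    module F = Functor F
    module U = Functor U
  field
    φ : ∀ {A B} → F.F₀ A D.⇒ B → A C.⇒ U.F₀ B
    ψ : ∀ {A B} → A C.⇒ U.F₀ B → F.F₀ A D.⇒ B
    φ-resp-≈ : ∀ {A B} {h h′ : F.F₀ A D.⇒ B} → h D.≈ h′ → φ h C.≈ φ h′
    ψ-resp-≈ : ∀ {A B} {k k′ : A C.⇒ U.F₀ B} → k C.≈ k′ → ψ k D.≈ ψ k′
    ψφ : ∀ {A B} (h : F.F₀ A D.⇒ B) → ψ (φ h) D.≈ h
    φψ : ∀ {A B} (k : A C.⇒ U.F₀ B) → φ (ψ k) C.≈ k
    φ-natural-A : ∀ {A A′ B} (a : A′ C.⇒ A) (h : F.F₀ A D.⇒ B) →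
                  φ (h D.∘ F.F₁ a) C.≈ φ h C.∘ a
    φ-natural-B : ∀ {A B B′} (b : B D.⇒ B′) (h : F.F₀ A D.⇒ B) →
                  φ (b D.∘ h) C.≈ U.F₁ b C.∘ φ h

-- A contravariant P : C → A is part of a dual adjunction: there is a
-- contravariant S : A → C and a natural bijection  C(X, S A) ≅ A(A, P X).
record DualAdjoint {o ℓ e o′ ℓ′ e′} {C : Category o ℓ e} {A : Category o′ ℓ′ e′}
       (P : ContraFunctor C A) : Set (o ⊔ ℓ ⊔ e ⊔ o′ ⊔ ℓ′ ⊔ e′) where
  private
    module C = Category C
    module A = Category A
    module P = ContraFunctor P
  field
    S : ContraFunctor A C
  private
    module S = ContraFunctor S
  field
    φ : ∀ {X a} → X C.⇒ S.F₀ a → a A.⇒ P.F₀ X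
    ψ : ∀ {X a} → a A.⇒ P.F₀ X → X C.⇒ S.F₀ a
    φ-resp-≈ : ∀ {X a} {h h′ : X C.⇒ S.F₀ a} → h C.≈ h′ → φ h A.≈ φ h′
    ψ-resp-≈ : ∀ {X a} {k k′ : a A.⇒ P.F₀ X} → k A.≈ k′ → ψ k C.≈ ψ k′
    ψφ : ∀ {X a} (h : X C.⇒ S.F₀ a) → ψ (φ h) C.≈ h
    φψ : ∀ {X a} (k : a A.⇒ P.F₀ X) → φ (ψ k) A.≈ k
    φ-natural-X : ∀ {X X′ a} (f : X′ C.⇒ X) (h : X C.⇒ S.F₀ a) →
                  φ (h C.∘ f) A.≈ P.F₁ f A.∘ φ h
    φ-natural-a : ∀ {X a a′} (g : a′ A.⇒ a) (h : X C.⇒ S.F₀ a) →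
                  φ (S.F₁ g C.∘ h) A.≈ φ h A.∘ g

module _ {o ℓ e} (C : Category o ℓ e) where
  open Category C

  record IsPullback {X Y Z Q : Obj} (f : X ⇒ Z) (g : Y ⇒ Z)
                    (p₁ : Q ⇒ X) (p₂ : Q ⇒ Y) : Set (o ⊔ ℓ ⊔ e) where
    field
      commute   : f ∘ p₁ ≈ g ∘ p₂
      universal : ∀ {W} (h₁ : W ⇒ X) (h₂ : W ⇒ Y) → f ∘ h₁ ≈ g ∘ h₂ → W ⇒ Q
      p₁∘universal : ∀ {W} {h₁ : W ⇒ X} {h₂ : W ⇒ Y} (eq : f ∘ h₁ ≈ g ∘ h₂) →
                     p₁ ∘ universal h₁ h₂ eq ≈ h₁
      p₂∘universal : ∀ {W} {h₁ : W ⇒ X} {h₂ : W ⇒ Y} (eq : f ∘ h₁ ≈ g ∘ h₂) →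
                     p₂ ∘ universal h₁ h₂ eq ≈ h₂
      unique    : ∀ {W} {h₁ : W ⇒ X} {h₂ : W ⇒ Y} (eq : f ∘ h₁ ≈ g ∘ h₂)
                  (u : W ⇒ Q) → p₁ ∘ u ≈ h₁ → p₂ ∘ u ≈ h₂ →
                  u ≈ universal h₁ h₂ eq

  record IsPushout {X Y Z Q : Obj} (f : Z ⇒ X) (g : Z ⇒ Y)
                   (i₁ : X ⇒ Q) (i₂ : Y ⇒ Q) : Set (o ⊔ ℓ ⊔ e) where
    field
      commute   : i₁ ∘ f ≈ i₂ ∘ g
      universal : ∀ {W} (h₁ : X ⇒ W) (h₂ : Y ⇒ W) → h₁ ∘ f ≈ h₂ ∘ g → Q ⇒ W
      universal∘i₁ : ∀ {W} {h₁ : X ⇒ W} {h₂ : Y ⇒ W} (eq : h₁ ∘ f ≈ h₂ ∘ g) →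
                     universal h₁ h₂ eq ∘ i₁ ≈ h₁
      universal∘i₂ : ∀ {W} {h₁ : X ⇒ W} {h₂ : Y ⇒ W} (eq : h₁ ∘ f ≈ h₂ ∘ g) →
                     universal h₁ h₂ eq ∘ i₂ ≈ h₂
      unique    : ∀ {W} {h₁ : X ⇒ W} {h₂ : Y ⇒ W} (eq : h₁ ∘ f ≈ h₂ ∘ g)
                  (u : Q ⇒ W) → u ∘ i₁ ≈ h₁ → u ∘ i₂ ≈ h₂ →
                  u ≈ universal h₁ h₂ eq

  HasPullbacks : Set (o ⊔ ℓ ⊔ e)
  HasPullbacks = ∀ {X Y Z} (f : X ⇒ Z) (g : Y ⇒ Z) →
    Σ Obj λ Q → Σ (Q ⇒ X) λ p₁ → Σ (Q ⇒ Y) λ p₂ → IsPullback f g p₁ p₂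

  HasPushouts : Set (o ⊔ ℓ ⊔ e)
  HasPushouts = ∀ {X Y Z} (f : Z ⇒ X) (g : Z ⇒ Y) →
    Σ Obj λ Q → Σ (X ⇒ Q) λ i₁ → Σ (Y ⇒ Q) λ i₂ → IsPushout f g i₁ i₂

  JointlyMono : ∀ {X₁ X₂ B : Obj} → B ⇒ X₁ → B ⇒ X₂ → Set (o ⊔ ℓ ⊔ e)
  JointlyMono {B = B} π₁ π₂ = ∀ {W} (h h′ : W ⇒ B) →
    π₁ ∘ h ≈ π₁ ∘ h′ → π₂ ∘ h ≈ π₂ ∘ h′ → h ≈ h′

record Coalgebra {o ℓ e} {C : Category o ℓ e} (T : Functor C C) : Set (o ⊔ ℓ) where
  open Category C
  field
    carrier : Obj
    γ       : carrier ⇒ Functor.F₀ T carrier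

-- A logic for T on A via P is (L, ρ) with  ρ : L P → P T.
-- IsBisimulation ρ c₁ c₂ π₁ π₂ : the jointly mono span (B, π₁, π₂) is a
-- ρ-bisimulation between c₁ and c₂, where the ρ-dual span (B̄, π̄₁, π̄₂) is
-- (any) pullback in A of  P X₁ --Pπ₁--> P B <--Pπ₂-- P X₂.
module _ {o ℓ e o′ ℓ′ e′} {C : Category o ℓ e} {A : Category o′ ℓ′ e′}
         {T : Functor C C} {P : ContraFunctor C A} {L : Functor A A} where
  private
    module C = Category C
    module A = Category A
    module P = ContraFunctor P
    module L = Functor L

  IsBisimulation : ContraNT (L ∘FC P) (P ∘CF T) →
                   (c₁ c₂ : Coalgebra T) {B : C.Obj} →
                   B C.⇒ Coalgebra.carrier c₁ → B C.⇒ Coalgebra.carrier c₂ →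
                   Set (o ⊔ ℓ ⊔ e ⊔ o′ ⊔ ℓ′ ⊔ e′)
  IsBisimulation ρ c₁ c₂ π₁ π₂ =
    JointlyMono C π₁ π₂ ×
    (∀ {B̄ : A.Obj} (π̄₁ : B̄ A.⇒ P.F₀ X₁) (π̄₂ : B̄ A.⇒ P.F₀ X₂) →
       IsPullback A (P.F₁ π₁) (P.F₁ π₂) π̄₁ π̄₂ →
       P.F₁ π₁ A.∘ P.F₁ γ₁ A.∘ ρ.η X₁ A.∘ L.F₁ π̄₁
         A.≈ P.F₁ π₂ A.∘ P.F₁ γ₂ A.∘ ρ.η X₂ A.∘ L.F₁ π̄₂)
    where
      module ρ = ContraNT ρ
      open Coalgebra c₁ renaming (carrier to X₁; γ to γ₁)
      open Coalgebra c₂ renaming (carrier to X₂; γ to γ₂)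

record Translation {o ℓ e o′ ℓ′ e′ o″ ℓ″ e″}
       {C : Category o ℓ e} {A : Category o′ ℓ′ e′} {A′ : Category o″ ℓ″ e″}
       {T : Functor C C} {U : Functor A′ A} {P′ : ContraFunctor C A′}
       {L′ : Functor A′ A′} {L : Functor A A}
       (ρ′ : ContraNT (L′ ∘FC P′) (P′ ∘CF T))
       (ρ  : ContraNT (L ∘FC (U ∘FC P′)) ((U ∘FC P′) ∘CF T))
       : Set (o ⊔ ℓ ⊔ e ⊔ o′ ⊔ ℓ′ ⊔ e′ ⊔ o″ ⊔ ℓ″ ⊔ e″) where
  private
    module A = Category A
  field
    τ : ContraNT (L ∘FC (U ∘FC P′)) (U ∘FC (L′ ∘FC P′))
    ρ≈Uρ′∘τ : ∀ X → ContraNT.η ρ X A.≈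
                    Functor.F₁ U (ContraNT.η ρ′ X) A.∘ ContraNT.η τ X

-- Push the span out to (Q, i₁, i₂). Since P′ and P = U P′ are dual adjoints they send
-- colimits to limits, so P′ and P turn this pushout into pullbacks. The ρ′-bisimulation
-- condition evaluated at the pullback (P′ Q, P′ i₁, P′ i₂) is an equation in A′. Any
-- ρ-dual span (B̄, π̄₁, π̄₂) factors through P Q by some k, and the translation
-- condition ρ = Uρ′ ∘ τ together with naturality of τ rewrites each side of the
-- ρ-bisimulation condition as U(the corresponding side of that A′-equation) ∘ τ_Q ∘ L k.
module Submission where

open import Defs
open import Level using (Level)
open import Data.Product using (_,_)
open import Relation.Binary using (Setoid; IsEquivalence)
import Relation.Binary.Reasoning.Setoid as SetoidReasoning

module HomReasoning {o ℓ e} (C : Category o ℓ e) {X Y : Category.Obj C} where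
  open Category C

  hom-setoid : Setoid ℓ e
  hom-setoid = record { Carrier = X ⇒ Y ; _≈_ = _≈_ ; isEquivalence = equiv }

  open IsEquivalence (equiv {X} {Y}) public using (refl; sym; trans)
  open SetoidReasoning hom-setoid public

  ∘-resp-≈ˡ : ∀ {Z} {f h : Y ⇒ Z} {g : X ⇒ Y} → f ≈ h → f ∘ g ≈ h ∘ g
  ∘-resp-≈ˡ p = ∘-resp-≈ p refl

  ∘-resp-≈ʳ : ∀ {W} {f : X ⇒ Y} {g i : W ⇒ X} → g ≈ i → f ∘ g ≈ f ∘ i
  ∘-resp-≈ʳ p = ∘-resp-≈ refl p

module _ {o ℓ e o′ ℓ′ e′} {C : Category o ℓ e} {D : Category o′ ℓ′ e′}
         (F : Functor C D) where
  private
    module C = Category C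
    module D = Category D
    open Functor F
    open HomReasoning D

  F₁-merge : ∀ {W X Y Z} {f : Y C.⇒ Z} {g : X C.⇒ Y} {h : W D.⇒ F₀ X} →
             F₁ f D.∘ (F₁ g D.∘ h) D.≈ F₁ (f C.∘ g) D.∘ h
  F₁-merge {f = f} {g} {h} = begin
    F₁ f D.∘ (F₁ g D.∘ h)  ≈⟨ D.assoc ⟨
    (F₁ f D.∘ F₁ g) D.∘ h  ≈⟨ ∘-resp-≈ˡ homomorphism ⟨
    F₁ (f C.∘ g) D.∘ h     ∎

module _ {o ℓ e o′ ℓ′ e′} {C : Category o ℓ e} {A : Category o′ ℓ′ e′}
         {P : ContraFunctor C A} (D : DualAdjoint P) where
  private
    module C = Category C
    module A = Category A
    module P = ContraFunctor P
    module A≈ = HomReasoning A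
    module C≈ = HomReasoning C
    open DualAdjoint D

  ψ-natural-X : ∀ {X X′ a} (f : X′ C.⇒ X) (k : a A.⇒ P.F₀ X) →
                ψ (P.F₁ f A.∘ k) C.≈ ψ k C.∘ f
  ψ-natural-X f k = begin
    ψ (P.F₁ f A.∘ k)          ≈⟨ ψ-resp-≈ (A≈.∘-resp-≈ʳ (φψ k)) ⟨
    ψ (P.F₁ f A.∘ φ (ψ k))    ≈⟨ ψ-resp-≈ (φ-natural-X f (ψ k)) ⟨
    ψ (φ (ψ k C.∘ f))         ≈⟨ ψφ _ ⟩
    ψ k C.∘ f                 ∎
    where open C≈

  pushout⇒pullback : ∀ {X₁ X₂ B Q} {π₁ : B C.⇒ X₁} {π₂ : B C.⇒ X₂}
                       {i₁ : X₁ C.⇒ Q} {i₂ : X₂ C.⇒ Q} →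
                     IsPushout C π₁ π₂ i₁ i₂ →
                     IsPullback A (P.F₁ π₁) (P.F₁ π₂) (P.F₁ i₁) (P.F₁ i₂)
  pushout⇒pullback {π₁ = π₁} {π₂} {i₁} {i₂} po = record
    { commute      = A≈.trans (A≈.sym P.homomorphism)
                       (A≈.trans (P.F-resp-≈ PO.commute) P.homomorphism)
    ; universal    = λ h₁ h₂ eq → φ (PO.universal (ψ h₁) (ψ h₂) (transpose eq))
    ; p₁∘universal = λ eq → A≈.trans (A≈.sym (φ-natural-X i₁ _))
                              (A≈.trans (φ-resp-≈ (PO.universal∘i₁ (transpose eq))) (φψ _))
    ; p₂∘universal = λ eq → A≈.trans (A≈.sym (φ-natural-X i₂ _))
                              (A≈.trans (φ-resp-≈ (PO.universal∘i₂ (transpose eq))) (φψ _))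
    ; unique       = λ eq u p₁u p₂u → A≈.trans (A≈.sym (φψ u))
                       (φ-resp-≈ (PO.unique (transpose eq) (ψ u)
                         (C≈.trans (C≈.sym (ψ-natural-X i₁ u)) (ψ-resp-≈ p₁u))
                         (C≈.trans (C≈.sym (ψ-natural-X i₂ u)) (ψ-resp-≈ p₂u))))
    }
    where
      module PO = IsPushout po
      transpose : ∀ {W} {h₁ : W A.⇒ P.F₀ _} {h₂ : W A.⇒ P.F₀ _} →
                  P.F₁ π₁ A.∘ h₁ A.≈ P.F₁ π₂ A.∘ h₂ → ψ h₁ C.∘ π₁ C.≈ ψ h₂ C.∘ π₂
      transpose eq = C≈.trans (C≈.sym (ψ-natural-X π₁ _))
                       (C≈.trans (ψ-resp-≈ eq) (ψ-natural-X π₂ _))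

module _ {o ℓ e o′ ℓ′ e′} {C : Category o ℓ e} {A : Category o′ ℓ′ e′}
         {T : Functor C C} {P : ContraFunctor C A} {L : Functor A A} where
  private
    module C = Category C
    module A = Category A
    module P = ContraFunctor P
    module L = Functor L

  bisimulationLeg : ContraNT (L ∘FC P) (P ∘CF T) → (c : Coalgebra T) {B : C.Obj} →
                    B C.⇒ Coalgebra.carrier c →
                    {B̄ : A.Obj} → B̄ A.⇒ P.F₀ (Coalgebra.carrier c) →
                    L.F₀ B̄ A.⇒ P.F₀ B
  bisimulationLeg ρ c π π̄ = P.F₁ π A.∘ P.F₁ γ A.∘ ContraNT.η ρ X A.∘ L.F₁ π̄
    where open Coalgebra c renaming (carrier to X)

module _ {o ℓ e o′ ℓ′ e′ o″ ℓ″ e″}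
         {C : Category o ℓ e} {A : Category o′ ℓ′ e′} {A′ : Category o″ ℓ″ e″}
         {T : Functor C C} {U : Functor A′ A} {P′ : ContraFunctor C A′}
         {L′ : Functor A′ A′} {L : Functor A A}
         {ρ′ : ContraNT (L′ ∘FC P′) (P′ ∘CF T)}
         {ρ : ContraNT (L ∘FC (U ∘FC P′)) ((U ∘FC P′) ∘CF T)}
         (tr : Translation {T = T} {U = U} {P′ = P′} {L′ = L′} {L = L} ρ′ ρ) where
  private
    module C = Category C
    module A = Category A
    module A′ = Category A′
    module U = Functor U
    module L = Functor L
    module L′ = Functor L′
    module P′ = ContraFunctor P′
    module ρ = ContraNT ρ
    module ρ′ = ContraNT ρ′
    open Translation tr
    module τ = ContraNT τ
    open HomReasoning A

    ρ-leg : (c : Coalgebra T) {B : C.Obj} → B C.⇒ Coalgebra.carrier c →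
            {B̄ : A.Obj} → B̄ A.⇒ U.F₀ (P′.F₀ (Coalgebra.carrier c)) →
            L.F₀ B̄ A.⇒ U.F₀ (P′.F₀ B)
    ρ-leg = bisimulationLeg {P = U ∘FC P′} {L = L} ρ

    ρ′-leg : (c : Coalgebra T) {B : C.Obj} → B C.⇒ Coalgebra.carrier c →
             {B̄ : A′.Obj} → B̄ A′.⇒ P′.F₀ (Coalgebra.carrier c) →
             L′.F₀ B̄ A′.⇒ P′.F₀ B
    ρ′-leg = bisimulationLeg {P = P′} {L = L′} ρ′

  ρ∘L-via-τ : ∀ {X Q B̄} (i : X C.⇒ Q) (k : B̄ A.⇒ U.F₀ (P′.F₀ Q)) →
              ρ.η X A.∘ L.F₁ (U.F₁ (P′.F₁ i) A.∘ k)
                A.≈ U.F₁ (ρ′.η X A′.∘ L′.F₁ (P′.F₁ i)) A.∘ (τ.η Q A.∘ L.F₁ k)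
  ρ∘L-via-τ {X} {Q} i k = begin
    ρ.η X A.∘ L.F₁ (UP′i A.∘ k)
      ≈⟨ A.∘-resp-≈ (ρ≈Uρ′∘τ X) L.homomorphism ⟩
    (Uρ′ A.∘ τ.η X) A.∘ (L.F₁ UP′i A.∘ L.F₁ k)
      ≈⟨ A.assoc ⟩
    Uρ′ A.∘ (τ.η X A.∘ (L.F₁ UP′i A.∘ L.F₁ k))
      ≈⟨ ∘-resp-≈ʳ A.assoc ⟨
    Uρ′ A.∘ ((τ.η X A.∘ L.F₁ UP′i) A.∘ L.F₁ k)
      ≈⟨ ∘-resp-≈ʳ (∘-resp-≈ˡ (τ.commute i)) ⟩
    Uρ′ A.∘ ((U.F₁ (L′.F₁ (P′.F₁ i)) A.∘ τ.η Q) A.∘ L.F₁ k)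
      ≈⟨ ∘-resp-≈ʳ A.assoc ⟩
    Uρ′ A.∘ (U.F₁ (L′.F₁ (P′.F₁ i)) A.∘ (τ.η Q A.∘ L.F₁ k))
      ≈⟨ F₁-merge U ⟩
    U.F₁ (ρ′.η X A′.∘ L′.F₁ (P′.F₁ i)) A.∘ (τ.η Q A.∘ L.F₁ k)
      ∎
    where
      UP′i : U.F₀ (P′.F₀ Q) A.⇒ U.F₀ (P′.F₀ X)
      UP′i = U.F₁ (P′.F₁ i)
      Uρ′ : U.F₀ (L′.F₀ (P′.F₀ X)) A.⇒ U.F₀ (P′.F₀ (Functor.F₀ T X))
      Uρ′ = U.F₁ (ρ′.η X)

  ρ-leg-via-τ :
    (c : Coalgebra T) {B Q : C.Obj} (π : B C.⇒ Coalgebra.carrier c)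
    (i : Coalgebra.carrier c C.⇒ Q) {B̄ : A.Obj} (k : B̄ A.⇒ U.F₀ (P′.F₀ Q))
    {π̄ : B̄ A.⇒ U.F₀ (P′.F₀ (Coalgebra.carrier c))} → U.F₁ (P′.F₁ i) A.∘ k A.≈ π̄ →
    ρ-leg c π π̄ A.≈ U.F₁ (ρ′-leg c π (P′.F₁ i)) A.∘ (τ.η Q A.∘ L.F₁ k)
  ρ-leg-via-τ c {Q = Q} π i {B̄} k {π̄} i∘k≈π̄ = begin
    UP′ π A.∘ UP′ γ A.∘ ρ.η X A.∘ L.F₁ π̄
      ≈⟨ ∘-resp-≈ʳ (∘-resp-≈ʳ (∘-resp-≈ʳ (L.F-resp-≈ i∘k≈π̄))) ⟨
    UP′ π A.∘ UP′ γ A.∘ ρ.η X A.∘ L.F₁ (UP′ i A.∘ k)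
      ≈⟨ ∘-resp-≈ʳ (∘-resp-≈ʳ (ρ∘L-via-τ i k)) ⟩
    UP′ π A.∘ UP′ γ A.∘ U.F₁ (ρ′.η X A′.∘ L′.F₁ (P′.F₁ i)) A.∘ τk
      ≈⟨ ∘-resp-≈ʳ (F₁-merge U) ⟩
    UP′ π A.∘ U.F₁ (P′.F₁ γ A′.∘ ρ′.η X A′.∘ L′.F₁ (P′.F₁ i)) A.∘ τk
      ≈⟨ F₁-merge U ⟩
    U.F₁ (ρ′-leg c π (P′.F₁ i)) A.∘ τk
      ∎
    where
      open Coalgebra c renaming (carrier to X)
      UP′ : ∀ {Y Z} → Y C.⇒ Z → U.F₀ (P′.F₀ Z) A.⇒ U.F₀ (P′.F₀ Y)
      UP′ f = U.F₁ (P′.F₁ f)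
      τk : L.F₀ B̄ A.⇒ U.F₀ (L′.F₀ (P′.F₀ Q))
      τk = τ.η Q A.∘ L.F₁ k

  translation-preserves-bisimulation :
    (c₁ c₂ : Coalgebra T) {B Q : C.Obj}
    {π₁ : B C.⇒ Coalgebra.carrier c₁} {π₂ : B C.⇒ Coalgebra.carrier c₂}
    {i₁ : Coalgebra.carrier c₁ C.⇒ Q} {i₂ : Coalgebra.carrier c₂ C.⇒ Q} →
    IsPullback A′ (P′.F₁ π₁) (P′.F₁ π₂) (P′.F₁ i₁) (P′.F₁ i₂) →
    IsPullback A (U.F₁ (P′.F₁ π₁)) (U.F₁ (P′.F₁ π₂))
                 (U.F₁ (P′.F₁ i₁)) (U.F₁ (P′.F₁ i₂)) →
    IsBisimulation {P = P′} {L = L′} ρ′ c₁ c₂ π₁ π₂ →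
    IsBisimulation {P = U ∘FC P′} {L = L} ρ c₁ c₂ π₁ π₂
  translation-preserves-bisimulation c₁ c₂ {Q = Q} {π₁ = π₁} {π₂} {i₁} {i₂}
    P′-pullback P-pullback (jointlyMono , ρ′-bisimilar) = jointlyMono , ρ-bisimilar
    where
      ρ-bisimilar : ∀ {B̄ : A.Obj} (π̄₁ : B̄ A.⇒ U.F₀ (P′.F₀ (Coalgebra.carrier c₁)))
                    (π̄₂ : B̄ A.⇒ U.F₀ (P′.F₀ (Coalgebra.carrier c₂))) →
                    IsPullback A (U.F₁ (P′.F₁ π₁)) (U.F₁ (P′.F₁ π₂)) π̄₁ π̄₂ →
                    ρ-leg c₁ π₁ π̄₁ A.≈ ρ-leg c₂ π₂ π̄₂
      ρ-bisimilar {B̄} π̄₁ π̄₂ dual-span = begin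
        ρ-leg c₁ π₁ π̄₁
          ≈⟨ ρ-leg-via-τ c₁ π₁ i₁ k (PQ.p₁∘universal Dual.commute) ⟩
        U.F₁ (ρ′-leg c₁ π₁ (P′.F₁ i₁)) A.∘ τk
          ≈⟨ ∘-resp-≈ˡ (U.F-resp-≈ (ρ′-bisimilar _ _ P′-pullback)) ⟩
        U.F₁ (ρ′-leg c₂ π₂ (P′.F₁ i₂)) A.∘ τk
          ≈⟨ ρ-leg-via-τ c₂ π₂ i₂ k (PQ.p₂∘universal Dual.commute) ⟨
        ρ-leg c₂ π₂ π̄₂
          ∎
        where
          module PQ = IsPullback P-pullback
          module Dual = IsPullback dual-span
          k : B̄ A.⇒ U.F₀ (P′.F₀ Q)
          k = PQ.universal π̄₁ π̄₂ Dual.commute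
          τk : L.F₀ B̄ A.⇒ U.F₀ (L′.F₀ (P′.F₀ Q))
          τk = τ.η Q A.∘ L.F₁ k

proposition4p10 : ∀ {o ℓ e o′ ℓ′ e′ o″ ℓ″ e″ : Level}
    (C : Category o ℓ e) (A : Category o′ ℓ′ e′) (A′ : Category o″ ℓ″ e″) →
    HasPullbacks C → HasPushouts C →
    (U : Functor A′ A) (F : Functor A A′) → Adjunction F U →
    (P′ : ContraFunctor C A′) → DualAdjoint P′ → DualAdjoint (U ∘FC P′) →
    (T : Functor C C)
    (L′ : Functor A′ A′) (ρ′ : ContraNT (L′ ∘FC P′) (P′ ∘CF T))
    (L : Functor A A) (ρ : ContraNT (L ∘FC (U ∘FC P′)) ((U ∘FC P′) ∘CF T)) →
    Translation {T = T} {U = U} {P′ = P′} {L′ = L′} {L = L} ρ′ ρ →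
    (c₁ c₂ : Coalgebra T) {B : Category.Obj C}
    (π₁ : Category._⇒_ C B (Coalgebra.carrier c₁))
    (π₂ : Category._⇒_ C B (Coalgebra.carrier c₂)) →
    IsBisimulation {P = P′} {L = L′} ρ′ c₁ c₂ π₁ π₂ →
    IsBisimulation {P = U ∘FC P′} {L = L} ρ c₁ c₂ π₁ π₂
proposition4p10 _ _ _ _ pushouts _ _ _ _ P′-dual P-dual _ _ _ _ _ tr c₁ c₂ π₁ π₂
  with pushouts π₁ π₂
... | _ , _ , _ , pushout =
  translation-preserves-bisimulation tr c₁ c₂
    (pushout⇒pullback P′-dual pushout) (pushout⇒pullback P-dual pushout)
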